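{- Let $\varphi$ be a primitive injective substitution over a finite alphabet $\mathcal A$ with fixed point $\mathbf u$, and assume that $\varphi$ and $\mathbf u$ satisfy Assumption B. Let $\mathbf w$ be an infinite LS branch of $\mathbf u$ and let $a,b\in\mathrm{Lext}(\mathbf w)$, $a\neq b$. Then one of the following holds: (1) $\mathbf w=\varphi^\ell(\mathbf w)$ for some $\ell\ge1$, and $\{a,b\}$ is a vertex of a cycle in $GL_\varphi$ all of whose edges are labelled by the empty word $\epsilon$; or (2) $\{a,b\}$ is a vertex of a cycle in $GL_\varphi$ containing at least one edge with a non-empty label, and, denoting by $\ell$ the length of this cycle and putting $$s=f_L(g_L^{\ell-1}(a,b))\,\varphi\bigl(f_L(g_L^{\ell-2}(a,b))\bigr)\cdots\varphi^{\ell-2}\bigl(f_L(g_L(a,b))\bigr)\,\varphi^{\ell-1}\bigl(f_L(a,b)\bigr),$$ the word $\mathbf w=s\,\varphi^\ell(s)\,\varphi^{2\ell}(s)\cdots$ is the unique solution of the equation $\mathbf w=s\,\varphi^\ell(\mathbf w)$.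
   Context: A substitution is a morphism $\varphi:\mathcal A^*\to\mathcal A^*$; it is primitive if there is $k$ such that $\varphi^k(a)$ contains $b$ for all $a,b\in\mathcal A$; $\mathbf u$ is a fixed point if $\mathbf u$ is an infinite word with $\varphi(\mathbf u)=\mathbf u$. For a factor $v$ of $\mathbf u$: $\mathrm{Lext}(v)=\{a\in\mathcal A: av \text{ is a factor of }\mathbf u\}$, $\mathrm{Rext}(v)=\{a\in\mathcal A: va\text{ is a factor}\}$; $v$ is left special (LS) if $\#\mathrm{Lext}(v)\ge2$. An infinite word $\mathbf w$ is an infinite LS branch of $\mathbf u$ if every prefix of $\mathbf w$ is an LS factor of $\mathbf u$; $\mathrm{Lext}(\mathbf w)$ is the intersection of $\mathrm{Lext}(v)$ over all prefixes $v$ of $\mathbf w$. For words, $wv^{ -1}$ denotes $w$ with its suffix $v$ removed. For distinct letters $a,b$, $f_L(a,b)$ is the longest common suffix of $\varphi(a)$ and $\varphi(b)$. For each unordered pair of distinct letters $a,b$ with $\mathrm{Rext}(a)\cap\mathrm{Rext}(b)\neq\emptyset$ the set $g_L(a,b)$ is defined by: (i) if $f_L(a,b)$ is a proper suffix of both $\varphi(a)$ and $\varphi(b)$, $g_L(a,b)$ consists of the last letters of $\varphi(a)f_L(a,b)^{ -1}$ and $\varphi(b)f_L(a,b)^{ -1}$; (ii) if $f_L(a,b)=\varphi(a)$, then $g_L(a,b)$ consists of the last letter of $\varphi(b)f_L(a,b)^{ -1}$ together with the last letters of all $\varphi(c)$ where $c\in\mathrm{Lext}(a)$ and $\mathrm{Rext}(ca)\cap\mathrm{Rext}(b)\neq\emptyset$.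 Assumption A: $\varphi$ is injective, has a fixed point $\mathbf u$, $\#g_L(a,b)=2$ whenever $g_L(a,b)$ is defined, and moreover if $f_L(a,b)=\varphi(a)$ and $d$ is the last letter of $\varphi(b)f_L(a,b)^{ -1}$ then for every $c\in\mathrm{Lext}(a)$ with $\mathrm{Rext}(ca)\cap\mathrm{Rext}(b)\neq\emptyset$, $d$ is not the last letter of $\varphi(c)$. Under Assumption A, the $f$-image of an LS factor or infinite LS branch $\mathbf w$ with respect to distinct left extensions $a,b$ is $f_L(a,b)\varphi(\mathbf w)$. Assumption B: Assumption A holds for $\varphi,\mathbf u$, and for every infinite LS branch $\mathbf w$ of $\mathbf u$ with distinct $a,b\in\mathrm{Lext}(\mathbf w)$ there is an infinite LS branch $\overline{\mathbf w}$ with distinct left extensions $c,d$ such that the $f$-image of $\overline{\mathbf w}$ with respect to $c,d$ equals $\mathbf w$ and $g_L(c,d)=\{a,b\}$. The graph $GL_\varphi$ is the directed labelled graph whose vertices are the unordered pairs $\{a,b\}$ of distinct letters with $\mathrm{Rext}(a)\cap\mathrm{Rext}(b)\neq\emptyset$, with an edge from $\{a,b\}$ to $g_L(a,b)$ labelled $f_L(a,b)$. $g_L^j$ denotes the $j$-fold iterate of $g_L$ on pairs. -}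

module Defs where

open import Data.Nat using (ℕ; zero; suc; _+_; _*_; _≤_; _<_)
open import Data.Fin using (Fin; _≟_)
open import Data.List using (List; []; _∷_; _++_; reverse; concatMap; length)
open import Data.List.Membership.Propositional using (_∈_)
open import Data.Product using (Σ; ∃; _×_; _,_)
open import Data.Sum using (_⊎_)
open import Relation.Nullary using (¬_; yes; no)
open import Relation.Binary.PropositionalEquality using (_≡_; _≢_)
open import Function.Bundles using (_⇔_)

Stream : ℕ → Set
Stream n = ℕ → Fin n

Subst : ℕ → Set
Subst n = Fin n → List (Fin n)

module _ {n : ℕ} where

  img : Subst n → List (Fin n) → List (Fin n)
  img σ xs = concatMap σ xs

  φpow : Subst n → ℕ → Subst n
  φpow σ zero a = a ∷ []
  φpow σ (suc k) a = img σ (φpow σ k a)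

  takeS : ℕ → Stream n → List (Fin n)
  takeS zero y = []
  takeS (suc k) y = y 0 ∷ takeS k (λ i → y (suc i))

  dropS : ℕ → Stream n → Stream n
  dropS k y i = y (k + i)

  PrefixS : List (Fin n) → Stream n → Set
  PrefixS xs y = takeS (length xs) y ≡ xs

  -- σ(x) = y for infinite words x, y : every image of a prefix of x is a
  -- prefix of y, and these images are unboundedly long (so σ(x) is infinite)
  ImgEq : Subst n → Stream n → Stream n → Set
  ImgEq σ x y = ((k : ℕ) → PrefixS (img σ (takeS k x)) y)
              × ((m : ℕ) → ∃ λ k → m ≤ length (img σ (takeS k x)))

  CatImgEq : List (Fin n) → Subst n → Stream n → Stream n → Set
  CatImgEq s σ x y = PrefixS s y × ImgEq σ x (dropS (length s) y)

  Injective : Subst n → Set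
  Injective φ = (xs ys : List (Fin n)) → img φ xs ≡ img φ ys → xs ≡ ys

  Primitive : Subst n → Set
  Primitive φ = ∃ λ k → (a b : Fin n) → b ∈ φpow φ k a

  Last : List (Fin n) → Fin n → Set
  Last w x = ∃ λ v → w ≡ v ++ (x ∷ [])

  LastOfStrip : List (Fin n) → List (Fin n) → Fin n → Set
  LastOfStrip w f x = ∃ λ v → w ≡ (v ++ (x ∷ [])) ++ f

  lcp : List (Fin n) → List (Fin n) → List (Fin n)
  lcp [] _ = []
  lcp (_ ∷ _) [] = []
  lcp (x ∷ xs) (y ∷ ys) with x ≟ y
  ... | yes _ = x ∷ lcp xs ys
  ... | no _ = []

  lcs : List (Fin n) → List (Fin n) → List (Fin n)
  lcs xs ys = reverse (lcp (reverse xs) (reverse ys))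

  Factor : Stream n → List (Fin n) → Set
  Factor u v = ∃ λ i → takeS (length v) (dropS i u) ≡ v

  InLext : Stream n → Fin n → List (Fin n) → Set
  InLext u a v = Factor u (a ∷ v)

  InRext : Stream n → List (Fin n) → Fin n → Set
  InRext u v a = Factor u (v ++ (a ∷ []))

  RextMeet : Stream n → List (Fin n) → List (Fin n) → Set
  RextMeet u v v' = ∃ λ x → InRext u v x × InRext u v' x

  LS : Stream n → List (Fin n) → Set
  LS u v = ∃ λ a → ∃ λ b → a ≢ b × InLext u a v × InLext u b v

  LSBranch : Stream n → Stream n → Set
  LSBranch u w = (k : ℕ) → LS u (takeS k w)

  -- a ∈ Lext(w) for an infinite word w (intersection over prefixes)
  InLextInf : Stream n → Fin n → Stream n → Set
  InLextInf u a w = (k : ℕ) → InLext u a (takeS k w)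

  fL : Subst n → Fin n → Fin n → List (Fin n)
  fL φ a b = lcs (φ a) (φ b)

  -- case (ii) with f_L(a,b) = φ(a): the letters of g_L(a,b)
  CaseII : Subst n → Stream n → Fin n → Fin n → Fin n → Set
  CaseII φ u a b x =
      LastOfStrip (φ b) (fL φ a b) x
    ⊎ (∃ λ c → InLext u c (a ∷ []) × RextMeet u (c ∷ a ∷ []) (b ∷ []) × Last (φ c) x)

  -- x ∈ g_L(a,b)   (for the unordered pair {a,b}; meaningful when defined)
  InG : Subst n → Stream n → Fin n → Fin n → Fin n → Set
  InG φ u a b x =
      (fL φ a b ≢ φ a × fL φ a b ≢ φ b
        × (LastOfStrip (φ a) (fL φ a b) x ⊎ LastOfStrip (φ b) (fL φ a b) x))
    ⊎ (fL φ a b ≡ φ a × CaseII φ u a b x)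
    ⊎ (fL φ b a ≡ φ b × CaseII φ u b a x)

  GEquals : Subst n → Stream n → Fin n → Fin n → Fin n → Fin n → Set
  GEquals φ u a b c d = (x : Fin n) → InG φ u a b x ⇔ (x ≡ c ⊎ x ≡ d)

  AssumptionA : Subst n → Stream n → Set
  AssumptionA φ u =
      Injective φ
    × ImgEq φ u u
    × ((a b : Fin n) → a ≢ b → RextMeet u (a ∷ []) (b ∷ []) →
         ∃ λ c → ∃ λ d → c ≢ d × GEquals φ u a b c d)
    × ((a b : Fin n) → a ≢ b → RextMeet u (a ∷ []) (b ∷ []) →
         fL φ a b ≡ φ a → (d : Fin n) → LastOfStrip (φ b) (fL φ a b) d →
         (c : Fin n) → InLext u c (a ∷ []) → RextMeet u (c ∷ a ∷ []) (b ∷ []) →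
         ¬ Last (φ c) d)

  -- the f-image of w̄ w.r.t. c,d is  f_L(c,d) φ(w̄)
  AssumptionB : Subst n → Stream n → Set
  AssumptionB φ u =
      AssumptionA φ u
    × ((w : Stream n) → LSBranch u w → (a b : Fin n) → a ≢ b →
         InLextInf u a w → InLextInf u b w →
         ∃ λ w̄ → ∃ λ c → ∃ λ d →
           LSBranch u w̄ × c ≢ d × InLextInf u c w̄ × InLextInf u d w̄
           × CatImgEq (fL φ c d) φ w̄ w
           × GEquals φ u c d a b)

  -- the graph GL_φ ; vertices = unordered pairs, represented by ordered pairs

  Pair : Set
  Pair = Fin n × Fin n

  SamePair : Pair → Pair → Set
  SamePair (a , b) (c , d) = (a ≡ c × b ≡ d) ⊎ (a ≡ d × b ≡ c)

  GEdge : Subst n → Stream n → Pair → Pair → Set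
  GEdge φ u (a , b) (c , d) =
    a ≢ b × RextMeet u (a ∷ []) (b ∷ []) × c ≢ d × GEquals φ u a b c d

  label : Subst n → Pair → List (Fin n)
  label φ (a , b) = fL φ a b

  -- p 0, …, p (ℓ-1) is a (simple) cycle of length ℓ ≥ 1 in GL_φ through {a,b}
  -- with p 0 = (a,b), so p j represents g_L^j(a,b)
  Cycle : Subst n → Stream n → Fin n → Fin n → ℕ → (ℕ → Pair) → Set
  Cycle φ u a b ℓ p =
      1 ≤ ℓ
    × p 0 ≡ (a , b)
    × ((i : ℕ) → i < ℓ → GEdge φ u (p i) (p (suc i)))
    × SamePair (p ℓ) (p 0)
    × ((i j : ℕ) → i < j → j < ℓ → ¬ SamePair (p i) (p j))

  -- s_k = f_L(p(k-1)) φ(f_L(p(k-2))) ⋯ φ^{k-1}(f_L(p 0))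
  sWord : Subst n → (ℕ → Pair) → ℕ → List (Fin n)
  sWord φ p zero = []
  sWord φ p (suc k) = label φ (p k) ++ img φ (sWord φ p k)

  partialCat : Subst n → List (Fin n) → ℕ → ℕ → List (Fin n)
  partialCat φ s ℓ zero = []
  partialCat φ s ℓ (suc k) = partialCat φ s ℓ k ++ img (φpow φ (k * ℓ)) s

module Submission where

-- Starting from (w, {a,b}), Assumption B yields a backward chain of infinite LS
-- branches W 0 = w, W 1, W 2, … with pairs q 0 = {a,b}, q 1, … such that
--   W k = f_L(q (k+1)) φ(W (k+1))   and   g_L(q (k+1)) = q k.
-- Since g_L is a function on the finitely many pairs, the pair sequence is backward
-- deterministic, hence purely periodic; its first return time D to {a,b} gives a cycle
-- p 0 = q 0, p 1 = q (D-1), …, p (D-1) = q 1 of GL_φ through {a,b}.  Telescoping D steps of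
-- the chain gives  V m = s φᴰ(V (m+1))  for V m = W (m·D) and s = sWord φ p D.
-- If s ≠ ε, the approximants s, s φᴰ(s), … are common prefixes of all V m and grow, so
-- w = V 0 is the unique solution of  w = s φᴰ(w).  If s = ε, the first letters of the V m
-- are again backward deterministic and so periodic; along a common period T (chosen also
-- beyond the primitivity exponent, so that φ^{T·D} doubles lengths) w is a fixed point.

open import Defs
open import Data.Nat using (ℕ; zero; suc; _+_; _*_; _∸_; _≤_; _<_; z≤n; s≤s)
open import Data.Nat.Properties
  using (≤-refl; ≤-trans; n≤1+n; +-mono-≤; +-monoʳ-≤; *-monoʳ-≤; +-suc; +-assoc; +-comm; *-assoc;
         m∸n≤m; <⇒≤;
         +-identityʳ; +-∸-assoc; n∸n≡0; m∸n+n≡m; m+[n∸m]≡n; m≤m+n; m≤n+m; m≤m*n; n<1+n;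
         m<n⇒m<1+n; m<1+n⇒m<n∨m≡n; m<1+n⇒m≤n)
open import Data.Fin using (Fin; toℕ; combine; _≟_)
open import Data.Fin.Properties using (pigeonhole; toℕ<n; combine-injective)
open import Data.List using (List; []; _∷_; _++_; length; head; reverse)
open import Data.List.Properties
  using (length-++; ++-assoc; ++-identityʳ; concatMap-++; concatMap-cong; concatMap-pure;
         ∷-injectiveˡ; ∷-injectiveʳ; ++-conicalˡ; ++-conicalʳ; length-++-≤ˡ)
open import Data.Maybe using (just)
open import Data.Maybe.Properties using (just-injective)
open import Data.Product using (∃; _×_; _,_; proj₁; proj₂)
open import Data.Sum using (_⊎_; inj₁; inj₂; swap; [_,_]′)
open import Data.Empty using (⊥-elim)
open import Function using (_∘_; id)
open import Data.List.Membership.Propositional using (_∈_)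
open import Data.List.Relation.Unary.Any using (here)
open import Relation.Nullary using (¬_; Dec; yes; no)
open import Relation.Nullary.Decidable using (_×-dec_; _⊎-dec_)
open import Function.Bundles using (mk⇔; Equivalence)
open import Level using (0ℓ)
open import Relation.Binary.Bundles using (Setoid)
open import Relation.Binary.PropositionalEquality

module _ {n : ℕ} where

  length-takeS : (k : ℕ) (y : Stream n) → length (takeS k y) ≡ k
  length-takeS zero    y = refl
  length-takeS (suc k) y = cong suc (length-takeS k (dropS 1 y))

  prefix-++ : (xs ys : List (Fin n)) (y : Stream n) →
              PrefixS xs y → PrefixS ys (dropS (length xs) y) → PrefixS (xs ++ ys) y
  prefix-++ []       ys y _ q = q
  prefix-++ (x ∷ xs) ys y p q =
    cong₂ _∷_ (∷-injectiveˡ p) (prefix-++ xs ys (dropS 1 y) (∷-injectiveʳ p) q)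

  prefix-split : (xs ys : List (Fin n)) (y : Stream n) →
                 PrefixS (xs ++ ys) y → PrefixS xs y × PrefixS ys (dropS (length xs) y)
  prefix-split []       ys y p = refl , p
  prefix-split (x ∷ xs) ys y p =
    let (p₁ , p₂) = prefix-split xs ys (dropS 1 y) (∷-injectiveʳ p)
    in cong₂ _∷_ (∷-injectiveˡ p) p₁ , p₂

  prefix-takeS : (k : ℕ) (xs : List (Fin n)) (y : Stream n) →
                 PrefixS xs y → k ≤ length xs → ∃ λ r → xs ≡ takeS k y ++ r
  prefix-takeS zero    xs       y _ _         = xs , refl
  prefix-takeS (suc k) (x ∷ xs) y p (s≤s k≤) =
    let (r , e) = prefix-takeS k xs (dropS 1 y) (∷-injectiveʳ p) k≤
    in r , cong₂ _∷_ (sym (∷-injectiveˡ p)) e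

  common-prefix : (xs : List (Fin n)) (y y′ : Stream n) → PrefixS xs y → PrefixS xs y′ →
                  (i : ℕ) → i < length xs → y i ≡ y′ i
  common-prefix (x ∷ xs) y y′ p p′ zero    _ = trans (∷-injectiveˡ p) (sym (∷-injectiveˡ p′))
  common-prefix (x ∷ xs) y y′ p p′ (suc i) (s≤s i<) =
    common-prefix xs (dropS 1 y) (dropS 1 y′) (∷-injectiveʳ p) (∷-injectiveʳ p′) i i<

  prefix-head : (xs : List (Fin n)) (y : Stream n) → PrefixS xs y → 1 ≤ length xs →
                head xs ≡ just (y 0)
  prefix-head (x ∷ xs) y p _ = cong just (sym (∷-injectiveˡ p))

  img-++ : (σ : Subst n) (xs ys : List (Fin n)) → img σ (xs ++ ys) ≡ img σ xs ++ img σ ys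
  img-++ σ = concatMap-++ σ

  img-img : (σ τ : Subst n) (xs : List (Fin n)) → img σ (img τ xs) ≡ img (λ a → img σ (τ a)) xs
  img-img σ τ []       = refl
  img-img σ τ (x ∷ xs) = trans (img-++ σ (τ x) (img τ xs)) (cong (img σ (τ x) ++_) (img-img σ τ xs))

  img-cong : (σ τ : Subst n) → (∀ a → σ a ≡ τ a) → (xs : List (Fin n)) → img σ xs ≡ img τ xs
  img-cong σ τ e = concatMap-cong e

  φpow-+ : (σ : Subst n) (k l : ℕ) (a : Fin n) → φpow σ (k + l) a ≡ img (φpow σ k) (φpow σ l a)
  φpow-+ σ zero    l a = sym (concatMap-pure (φpow σ l a))
  φpow-+ σ (suc k) l a = trans (cong (img σ) (φpow-+ σ k l a)) (img-img σ (φpow σ k) (φpow σ l a))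

  img-φpow-+ : (σ : Subst n) (k l : ℕ) (xs : List (Fin n)) →
               img (φpow σ (k + l)) xs ≡ img (φpow σ k) (img (φpow σ l) xs)
  img-φpow-+ σ k l xs =
    trans (img-cong _ _ (φpow-+ σ k l) xs) (sym (img-img (φpow σ k) (φpow σ l) xs))

  φpow-* : (σ : Subst n) (k l : ℕ) (a : Fin n) → φpow (φpow σ k) l a ≡ φpow σ (l * k) a
  φpow-* σ k zero    a = refl
  φpow-* σ k (suc l) a = trans (cong (img (φpow σ k)) (φpow-* σ k l a)) (sym (φpow-+ σ k (l * k) a))

  NonErasing : Subst n → Set
  NonErasing σ = ∀ a → 1 ≤ length (σ a)

  Doubling : Subst n → Set
  Doubling σ = ∀ a → 2 ≤ length (σ a)

  img-length : (σ : Subst n) → NonErasing σ → (xs : List (Fin n)) → length xs ≤ length (img σ xs)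
  img-length σ ne []       = z≤n
  img-length σ ne (x ∷ xs) =
    subst (suc (length xs) ≤_) (sym (length-++ (σ x))) (+-mono-≤ (ne x) (img-length σ ne xs))

  img-length-doubling : (σ : Subst n) → Doubling σ → (xs : List (Fin n)) →
                        length xs + length xs ≤ length (img σ xs)
  img-length-doubling σ db []       = z≤n
  img-length-doubling σ db (x ∷ xs) =
    subst₂ _≤_ (cong suc (sym (+-suc (length xs) (length xs)))) (sym (length-++ (σ x)))
      (+-mono-≤ (db x) (img-length-doubling σ db xs))

  φpow-nonErasing : (σ : Subst n) → NonErasing σ → (k : ℕ) → NonErasing (φpow σ k)
  φpow-nonErasing σ ne zero    a = s≤s z≤n
  φpow-nonErasing σ ne (suc k) a = ≤-trans (φpow-nonErasing σ ne k a) (img-length σ ne (φpow σ k a))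

  -- the second half of ImgEq: σ(x) is infinite
  Unbounded : Subst n → Stream n → Set
  Unbounded σ x = (m : ℕ) → ∃ λ k → m ≤ length (img σ (takeS k x))

  unbounded : (σ : Subst n) → NonErasing σ → (x : Stream n) → Unbounded σ x
  unbounded σ ne x m =
    m , subst (_≤ length (img σ (takeS m x))) (length-takeS m x) (img-length σ ne (takeS m x))

  catImg-intro : (f : List (Fin n)) (σ : Subst n) (x y : Stream n) →
                 (∀ k → PrefixS (f ++ img σ (takeS k x)) y) → Unbounded σ x → CatImgEq f σ x y
  catImg-intro f σ x y pre ub =
    proj₁ (prefix-split f [] y (pre 0)) , (λ k → proj₂ (prefix-split f _ y (pre k))) , ub

  catImg-prefix : (f : List (Fin n)) (σ : Subst n) (x y : Stream n) → CatImgEq f σ x y →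
                  ∀ k → PrefixS (f ++ img σ (takeS k x)) y
  catImg-prefix f σ x y (pf , pre , _) k = prefix-++ f _ y pf (pre k)

  catImg-identity : (σ : Subst n) (y : Stream n) → CatImgEq [] (φpow σ 0) y y
  catImg-identity σ y = catImg-intro [] (φpow σ 0) y y pre (unbounded _ (λ _ → s≤s z≤n) y)
    where
      pre : ∀ k → PrefixS (img (φpow σ 0) (takeS k y)) y
      pre k = trans (cong (λ m → takeS m y) (trans (cong length (concatMap-pure (takeS k y)))
                                                    (length-takeS k y)))
                    (sym (concatMap-pure (takeS k y)))

  catImg-compose : (f g : List (Fin n)) (σ τ : Subst n) (x y z : Stream n) → NonErasing σ →
                   CatImgEq f σ x y → CatImgEq g τ z x →
                   CatImgEq (f ++ img σ g) (λ a → img σ (τ a)) z y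
  catImg-compose f g σ τ x y z ne y≡fσx x≡gτz = catImg-intro _ _ z y pre ub
    where
      pre : ∀ k → PrefixS ((f ++ img σ g) ++ img (λ a → img σ (τ a)) (takeS k z)) y
      pre k = subst (λ v → PrefixS v y) regroup
                    (catImg-prefix f σ x y y≡fσx (length (g ++ img τ (takeS k z))))
        where
          open ≡-Reasoning
          t = takeS k z
          regroup : f ++ img σ (takeS (length (g ++ img τ t)) x)
                  ≡ (f ++ img σ g) ++ img (λ a → img σ (τ a)) t
          regroup = begin
            f ++ img σ (takeS (length (g ++ img τ t)) x)
              ≡⟨ cong (λ v → f ++ img σ v) (catImg-prefix g τ z x x≡gτz k) ⟩
            f ++ img σ (g ++ img τ t)                  ≡⟨ cong (f ++_) (img-++ σ g (img τ t)) ⟩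
            f ++ (img σ g ++ img σ (img τ t))          ≡⟨ sym (++-assoc f (img σ g) _) ⟩
            (f ++ img σ g) ++ img σ (img τ t)          ≡⟨ cong ((f ++ img σ g) ++_) (img-img σ τ t) ⟩
            (f ++ img σ g) ++ img (λ a → img σ (τ a)) t ∎
      ub : Unbounded (λ a → img σ (τ a)) z
      ub m = let (k , m≤) = proj₂ (proj₂ x≡gτz) m in
        k , ≤-trans m≤ (subst (length (img τ (takeS k z)) ≤_) (cong length (img-img σ τ (takeS k z)))
                               (img-length σ ne (img τ (takeS k z))))

  imgEq-cong : (σ τ : Subst n) (x y : Stream n) → (∀ a → σ a ≡ τ a) → ImgEq σ x y → ImgEq τ x y
  imgEq-cong σ τ x y e (pre , ub) =
    (λ k → subst (λ v → PrefixS v y) (img-cong σ τ e (takeS k x)) (pre k)) ,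
    λ m → let (k , m≤) = ub m in k , subst (m ≤_) (cong length (img-cong σ τ e (takeS k x))) m≤

  -- Solving  y = s σ(y)  by approximants.

  approx : List (Fin n) → Subst n → List (Fin n) → ℕ → List (Fin n)
  approx s σ a₀ zero    = a₀
  approx s σ a₀ (suc k) = s ++ img σ (approx s σ a₀ k)

  approx-prefix : (s : List (Fin n)) (σ : Subst n) (a₀ : List (Fin n)) (V : ℕ → Stream n) →
                  (∀ m → CatImgEq s σ (V (suc m)) (V m)) → (∀ m → PrefixS a₀ (V m)) →
                  ∀ k m → PrefixS (approx s σ a₀ k) (V m)
  approx-prefix s σ a₀ V chain start zero    m = start m
  approx-prefix s σ a₀ V chain start (suc k) m =
    subst (λ v → PrefixS (s ++ img σ v) (V m)) (approx-prefix s σ a₀ V chain start k (suc m))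
          (catImg-prefix s σ (V (suc m)) (V m) (chain m) (length (approx s σ a₀ k)))

  approx-solution : (s : List (Fin n)) (σ : Subst n) (a₀ : List (Fin n)) → NonErasing σ →
                    (∀ k → k ≤ length (approx s σ a₀ k)) →
                    (y : Stream n) → (∀ k → PrefixS (approx s σ a₀ k) y) → CatImgEq s σ y y
  approx-solution s σ a₀ ne long y pre = catImg-intro s σ y y pre′ (unbounded σ ne y)
    where
      pre′ : ∀ k → PrefixS (s ++ img σ (takeS k y)) y
      pre′ k = proj₁ (prefix-split _ (img σ r) y (subst (λ v → PrefixS v y) regroup (pre (suc k))))
        where
          open ≡-Reasoning
          r = proj₁ (prefix-takeS k (approx s σ a₀ k) y (pre k) (long k))
          regroup : approx s σ a₀ (suc k) ≡ (s ++ img σ (takeS k y)) ++ img σ r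
          regroup = begin
            s ++ img σ (approx s σ a₀ k)
              ≡⟨ cong (λ v → s ++ img σ v) (proj₂ (prefix-takeS k _ y (pre k) (long k))) ⟩
            s ++ img σ (takeS k y ++ r)               ≡⟨ cong (s ++_) (img-++ σ (takeS k y) r) ⟩
            s ++ (img σ (takeS k y) ++ img σ r)       ≡⟨ sym (++-assoc s _ _) ⟩
            (s ++ img σ (takeS k y)) ++ img σ r       ∎

  approx-unique : (s : List (Fin n)) (σ : Subst n) (a₀ : List (Fin n)) →
                  (∀ k → k ≤ length (approx s σ a₀ k)) → (y y′ : Stream n) →
                  (∀ k → PrefixS (approx s σ a₀ k) y) → (∀ k → PrefixS (approx s σ a₀ k) y′) →
                  ∀ i → y i ≡ y′ i
  approx-unique s σ a₀ long y y′ pre pre′ i =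
    common-prefix (approx s σ a₀ (suc i)) y y′ (pre (suc i)) (pre′ (suc i)) i (long (suc i))

  approx-long : (s : List (Fin n)) (σ : Subst n) (a₀ : List (Fin n)) → 1 ≤ length s →
                NonErasing σ → ∀ k → k ≤ length (approx s σ a₀ k)
  approx-long s σ a₀ 1≤s ne zero    = z≤n
  approx-long s σ a₀ 1≤s ne (suc k) =
    subst (suc k ≤_) (sym (length-++ s))
          (+-mono-≤ 1≤s (≤-trans (approx-long s σ a₀ 1≤s ne k) (img-length σ ne (approx s σ a₀ k))))

  approx-long-doubling : (σ : Subst n) (a₀ : List (Fin n)) → Doubling σ → 1 ≤ length a₀ →
                         ∀ k → suc k ≤ length (approx [] σ a₀ k)
  approx-long-doubling σ a₀ db 1≤a₀ zero    = 1≤a₀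
  approx-long-doubling σ a₀ db 1≤a₀ (suc k) =
    ≤-trans (+-mono-≤ (≤-trans (s≤s z≤n) ih) ih) (img-length-doubling σ db (approx [] σ a₀ k))
    where ih = approx-long-doubling σ a₀ db 1≤a₀ k

  -- Telescoping a chain  W j = f j σ(W (j+1)).

  telescope : (ℕ → List (Fin n)) → Subst n → ℕ → ℕ → List (Fin n)
  telescope f σ j zero    = []
  telescope f σ j (suc t) = f j ++ img σ (telescope f σ (suc j) t)

  telescope-relation : (σ : Subst n) → NonErasing σ → (f : ℕ → List (Fin n)) (W : ℕ → Stream n) →
                       (∀ j → CatImgEq (f j) σ (W (suc j)) (W j)) →
                       ∀ t j → CatImgEq (telescope f σ j t) (φpow σ t) (W (t + j)) (W j)
  telescope-relation σ ne f W step zero    j = catImg-identity σ (W j)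
  telescope-relation σ ne f W step (suc t) j =
    catImg-compose (f j) (telescope f σ (suc j) t) σ (φpow σ t) (W (suc j)) (W j) (W (suc t + j)) ne
      (step j)
      (subst (λ m → CatImgEq (telescope f σ (suc j) t) (φpow σ t) (W m) (W (suc j))) (+-suc t j)
             (telescope-relation σ ne f W step t (suc j)))

  telescope-empty : (σ : Subst n) → ∀ j t → telescope (λ _ → []) σ j t ≡ []
  telescope-empty σ j zero    = refl
  telescope-empty σ j (suc t) = cong (img σ) (telescope-empty σ (suc j) t)

  -- The word sWord φ p t read as a telescope along the reversed path.
  telescope-sWord : (φ : Subst n) (f : ℕ → List (Fin n)) (p : ℕ → Pair) → ∀ t j →
                    (∀ i → i < t → label φ (p i) ≡ f (j + (t ∸ suc i))) →
                    telescope f φ j t ≡ sWord φ p t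
  telescope-sWord φ f p zero    j h = refl
  telescope-sWord φ f p (suc t) j h =
    cong₂ _++_ (sym (trans (h t ≤-refl) (cong f lastIndex)))
               (cong (img φ) (telescope-sWord φ f p t (suc j) h′))
    where
      lastIndex : j + (t ∸ t) ≡ j
      lastIndex = trans (cong (j +_) (n∸n≡0 t)) (+-identityʳ j)
      h′ : ∀ i → i < t → label φ (p i) ≡ f (suc j + (t ∸ suc i))
      h′ i i<t = trans (h i (m<n⇒m<1+n i<t))
                       (cong f (trans (cong (j +_) (+-∸-assoc 1 i<t)) (+-suc j (t ∸ suc i))))

  img-empty : (σ : Subst n) → NonErasing σ → (xs : List (Fin n)) → img σ xs ≡ [] → xs ≡ []
  img-empty σ ne []       _ = refl
  img-empty σ ne (x ∷ xs) e with subst (1 ≤_) (cong length e) (≤-trans (ne x) (length-++-≤ˡ (σ x)))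
  ... | ()

  img-nonempty : (σ : Subst n) (xs : List (Fin n)) → 1 ≤ length (img σ xs) → 1 ≤ length xs
  img-nonempty σ (x ∷ xs) _ = s≤s z≤n

  sWord-empty : (φ : Subst n) → NonErasing φ → (p : ℕ → Pair) → ∀ t → sWord φ p t ≡ [] →
                ∀ i → i < t → label φ (p i) ≡ []
  sWord-empty φ ne p (suc t) e i i<1+t with m<1+n⇒m<n∨m≡n i<1+t
  ... | inj₂ refl = ++-conicalˡ (label φ (p t)) _ e
  ... | inj₁ i<t  =
    sWord-empty φ ne p t (img-empty φ ne _ (++-conicalʳ (label φ (p t)) _ e)) i i<t

  sWord-nonempty : (φ : Subst n) (p : ℕ → Pair) → ∀ t → 1 ≤ length (sWord φ p t) →
                   ∃ λ i → i < t × label φ (p i) ≢ []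
  sWord-nonempty φ p (suc t) h = split (label φ (p t)) refl
    where
      split : (l : List (Fin n)) → label φ (p t) ≡ l → ∃ λ i → i < suc t × label φ (p i) ≢ []
      split (x ∷ xs) eq = t , ≤-refl , λ e → ∷≢[] (trans (sym eq) e)
        where ∷≢[] : x ∷ xs ≢ []
              ∷≢[] ()
      split []       eq =
        let h′ = subst (λ l → 1 ≤ length (l ++ img φ (sWord φ p t))) eq h
            (i , i<t , ne) = sWord-nonempty φ p t (img-nonempty φ (sWord φ p t) h′)
        in i , m<n⇒m<1+n i<t , ne

  empty-or-nonempty : (xs : List (Fin n)) → xs ≡ [] ⊎ 1 ≤ length xs
  empty-or-nonempty []      = inj₁ refl
  empty-or-nonempty (_ ∷ _) = inj₂ (s≤s z≤n)

  partialCat-suc : (φ : Subst n) (s : List (Fin n)) (ℓ : ℕ) → ∀ k →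
                   partialCat φ s ℓ (suc k) ≡ s ++ img (φpow φ ℓ) (partialCat φ s ℓ k)
  partialCat-suc φ s ℓ zero    = trans (concatMap-pure s) (sym (++-identityʳ s))
  partialCat-suc φ s ℓ (suc k) = begin
      pc (suc k) ++ img (φpow φ (ℓ + k * ℓ)) s
        ≡⟨ cong₂ _++_ (partialCat-suc φ s ℓ k) (img-φpow-+ φ ℓ (k * ℓ) s) ⟩
      (s ++ img ψ (pc k)) ++ img ψ (img (φpow φ (k * ℓ)) s)
        ≡⟨ ++-assoc s _ _ ⟩
      s ++ (img ψ (pc k) ++ img ψ (img (φpow φ (k * ℓ)) s))
        ≡⟨ cong (s ++_) (sym (img-++ ψ (pc k) _)) ⟩
      s ++ img ψ (pc (suc k)) ∎
    where
      open ≡-Reasoning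
      ψ = φpow φ ℓ
      pc = partialCat φ s ℓ

  partialCat-approx : (φ : Subst n) (s : List (Fin n)) (ℓ : ℕ) → ∀ k →
                      partialCat φ s ℓ k ≡ approx s (φpow φ ℓ) [] k
  partialCat-approx φ s ℓ zero    = refl
  partialCat-approx φ s ℓ (suc k) =
    trans (partialCat-suc φ s ℓ k) (cong (λ v → s ++ img (φpow φ ℓ) v) (partialCat-approx φ s ℓ k))

least : (P : ℕ → Set) → (∀ t → Dec (P t)) → ∀ m → P m → ∃ λ k → P k × (∀ j → j < k → ¬ P j)
least P dec m pm with dec 0
... | yes p0 = 0 , p0 , λ _ ()
least P dec zero    pm | no ¬p0 = ⊥-elim (¬p0 pm)
least P dec (suc m) pm | no ¬p0 =
  let (k , pk , below) = least (λ t → P (suc t)) (λ t → dec (suc t)) m pm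
  in suc k , pk , λ { zero _ → ¬p0 ; (suc j) (s≤s j<k) → below j j<k }

-- A sequence q in a finite setoid that is backward deterministic
-- (q (s+1) ≈ q (t+1) implies q s ≈ q t) is purely periodic.
module BackwardDeterministic
  {c ℓ} (S : Setoid c ℓ) (N : ℕ) (code : Setoid.Carrier S → Fin N)
  (code-reflects : ∀ {x y} → code x ≡ code y → Setoid._≈_ S x y)
  (q : ℕ → Setoid.Carrier S)
  (backward : ∀ {s t} → Setoid._≈_ S (q (suc s)) (q (suc t)) → Setoid._≈_ S (q s) (q t))
  where

  open Setoid S using (_≈_) renaming (reflexive to ≈-reflexive; sym to ≈-sym; trans to ≈-trans)
  open import Relation.Binary.Reasoning.Setoid S

  shiftBack : ∀ r s t → q (r + s) ≈ q (r + t) → q s ≈ q t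
  shiftBack zero    s t h = h
  shiftBack (suc r) s t h = shiftBack r s t (backward h)

  -- Pigeonhole: beyond every position L some value recurs within at most N steps.
  window : ∀ L → ∃ λ x → ∃ λ P → L ≤ x × suc P ≤ N × q x ≈ q (x + suc P)
  window L with pigeonhole (n<1+n N) (λ i → code (q (L + toℕ i)))
  ... | i , j , i<j , same = L + toℕ i , P , m≤m+n L (toℕ i) , P<N , recur
    where
      P = toℕ j ∸ suc (toℕ i)
      gap : toℕ i + suc P ≡ toℕ j
      gap = trans (+-suc (toℕ i) P) (m+[n∸m]≡n i<j)
      P<N : suc P ≤ N
      P<N = ≤-trans (subst (suc P ≤_) gap (m≤n+m (suc P) (toℕ i))) (m<1+n⇒m≤n (toℕ<n j))
      recur : q (L + toℕ i) ≈ q (L + toℕ i + suc P)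
      recur = ≈-trans (code-reflects same)
        (≈-reflexive (cong q (trans (cong (L +_) (sym gap)) (sym (+-assoc L (toℕ i) (suc P))))))

  repeatBelow : ∀ {x P} → q x ≈ q (x + suc P) → ∀ y → y ≤ x → q y ≈ q (y + suc P)
  repeatBelow {x} {P} h y y≤x = shiftBack (x ∸ y) y (y + suc P) (begin
    q (x ∸ y + y)           ≡⟨ cong q (m∸n+n≡m y≤x) ⟩
    q x                     ≈⟨ h ⟩
    q (x + suc P)           ≡⟨ cong q (trans (cong (_+ suc P) (sym (m∸n+n≡m y≤x)))
                                             (+-assoc (x ∸ y) y (suc P))) ⟩
    q (x ∸ y + (y + suc P)) ∎)

  repeatMany : ∀ {x P} → q x ≈ q (x + suc P) → ∀ c b → b + c * suc P ≤ x →
               q b ≈ q (b + c * suc P)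
  repeatMany     h zero    b _  = ≈-reflexive (cong q (sym (+-identityʳ b)))
  repeatMany {x} {P} h (suc c) b le = begin
    q b                     ≈⟨ repeatMany h c b le′ ⟩
    q (b + c * E)           ≈⟨ repeatBelow h (b + c * E) le′ ⟩
    q (b + c * E + E)       ≡⟨ cong q (trans (+-assoc b (c * E) E) (cong (b +_) (+-comm (c * E) E))) ⟩
    q (b + suc c * E)       ∎
    where
      E = suc P
      le′ : b + c * E ≤ x
      le′ = ≤-trans (+-monoʳ-≤ b (m≤n+m (c * E) E)) le

  recurrence : ∃ λ P → q 0 ≈ q (suc P)
  recurrence = let (x , P , _ , _ , h) = window 0 in P , repeatBelow h 0 z≤n

  periodic : ∀ {D} → q 0 ≈ q D → ∀ k → q k ≈ q (k + D)
  periodic {D} q0≈qD k with window (D + k * N)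
  ... | x , P , L≤x , E≤N , h = shiftBack r k (k + D) (begin
    q (r + k)       ≡⟨ cong q (m∸n+n≡m k≤kE) ⟩
    q (k * E)       ≈⟨ ≈-sym (repeatMany h k 0 (≤-trans kE≤kN (≤-trans (m≤n+m (k * N) D) L≤x))) ⟩
    q 0             ≈⟨ q0≈qD ⟩
    q D             ≈⟨ repeatMany h k D (≤-trans (+-monoʳ-≤ D kE≤kN) L≤x) ⟩
    q (D + k * E)   ≡⟨ cong q shuffle ⟩
    q (r + (k + D)) ∎)
    where
      E = suc P
      kE≤kN : k * E ≤ k * N
      kE≤kN = *-monoʳ-≤ k E≤N
      k≤kE : k ≤ k * E
      k≤kE = m≤m*n k E
      r = k * E ∸ k
      shuffle : D + k * E ≡ r + (k + D)
      shuffle = trans (+-comm D (k * E))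
                      (trans (cong (_+ D) (sym (m∸n+n≡m k≤kE))) (+-assoc r k D))

  periodic-* : ∀ {D} → q 0 ≈ q D → ∀ m k → q k ≈ q (k + m * D)
  periodic-*         q0≈qD zero    k = ≈-reflexive (cong q (sym (+-identityʳ k)))
  periodic-* {D} q0≈qD (suc m) k = begin
    q k               ≈⟨ periodic-* q0≈qD m k ⟩
    q (k + m * D)     ≈⟨ periodic q0≈qD (k + m * D) ⟩
    q (k + m * D + D) ≡⟨ cong q (trans (+-assoc k (m * D) D) (cong (k +_) (+-comm (m * D) D))) ⟩
    q (k + suc m * D) ∎

module _ {n : ℕ} where

  open Equivalence

  SamePair-refl : {p : Pair {n}} → SamePair p p
  SamePair-refl {a , b} = inj₁ (refl , refl)

  SamePair-sym : {p p′ : Pair {n}} → SamePair p p′ → SamePair p′ p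
  SamePair-sym (inj₁ (refl , refl)) = inj₁ (refl , refl)
  SamePair-sym (inj₂ (refl , refl)) = inj₂ (refl , refl)

  SamePair-trans : {p p′ p″ : Pair {n}} → SamePair p p′ → SamePair p′ p″ → SamePair p p″
  SamePair-trans (inj₁ (refl , refl)) h                    = h
  SamePair-trans (inj₂ (refl , refl)) (inj₁ (refl , refl)) = inj₂ (refl , refl)
  SamePair-trans (inj₂ (refl , refl)) (inj₂ (refl , refl)) = inj₁ (refl , refl)

  SamePair? : (p p′ : Pair {n}) → Dec (SamePair p p′)
  SamePair? (a , b) (c , d) = ((a ≟ c) ×-dec (b ≟ d)) ⊎-dec ((a ≟ d) ×-dec (b ≟ c))

  pairSetoid : Setoid 0ℓ 0ℓ
  pairSetoid = record
    { Carrier       = Pair {n}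
    ; _≈_           = SamePair
    ; isEquivalence = record { refl = SamePair-refl ; sym = SamePair-sym ; trans = SamePair-trans }
    }

  pairCode : Pair {n} → Fin (n * n)
  pairCode (a , b) = combine a b

  pairCode-reflects : {p p′ : Pair {n}} → pairCode p ≡ pairCode p′ → SamePair p p′
  pairCode-reflects {a , b} {c , d} e with combine-injective a b c d e
  ... | refl , refl = SamePair-refl

  lcp-sym : (xs ys : List (Fin n)) → lcp xs ys ≡ lcp ys xs
  lcp-sym []       []       = refl
  lcp-sym []       (_ ∷ _)  = refl
  lcp-sym (_ ∷ _)  []       = refl
  lcp-sym (x ∷ xs) (y ∷ ys) with x ≟ y | y ≟ x
  ... | yes refl | yes _    = cong (x ∷_) (lcp-sym xs ys)
  ... | yes refl | no x≢x   = ⊥-elim (x≢x refl)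
  ... | no x≢x   | yes refl = ⊥-elim (x≢x refl)
  ... | no _     | no _     = refl

  fL-sym : (φ : Subst n) (a b : Fin n) → fL φ a b ≡ fL φ b a
  fL-sym φ a b = cong reverse (lcp-sym (reverse (φ a)) (reverse (φ b)))

  label-resp : (φ : Subst n) {p p′ : Pair {n}} → SamePair p p′ → label φ p ≡ label φ p′
  label-resp φ (inj₁ (refl , refl)) = refl
  label-resp φ {a , b} (inj₂ (refl , refl)) = fL-sym φ a b

  InG-swap : (φ : Subst n) (u : Stream n) (a b x : Fin n) → InG φ u a b x → InG φ u b a x
  InG-swap φ u a b x (inj₁ (≢φa , ≢φb , last)) =
    inj₁ (subst (λ f → f ≢ φ b × f ≢ φ a × (LastOfStrip (φ b) f x ⊎ LastOfStrip (φ a) f x))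
                (fL-sym φ a b) (≢φb , ≢φa , swap last))
  InG-swap φ u a b x (inj₂ (inj₁ h)) = inj₂ (inj₂ h)
  InG-swap φ u a b x (inj₂ (inj₂ h)) = inj₂ (inj₁ h)

  GEquals-resp : (φ : Subst n) (u : Stream n) {a b a′ b′ c d c′ d′ : Fin n} →
                 SamePair (a , b) (a′ , b′) → SamePair (c , d) (c′ , d′) →
                 GEquals φ u a b c d → GEquals φ u a′ b′ c′ d′
  GEquals-resp φ u sab scd g x =
    mk⇔ (λ h → target scd (to (g x) (source (SamePair-sym sab) h)))
        (λ h → source sab (from (g x) (target (SamePair-sym scd) h)))
    where
      source : ∀ {a b a′ b′} → SamePair (a , b) (a′ , b′) → InG φ u a b x → InG φ u a′ b′ x
      source (inj₁ (refl , refl)) h = h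
      source (inj₂ (refl , refl)) h = InG-swap φ u _ _ x h
      target : ∀ {c d c′ d′} → SamePair (c , d) (c′ , d′) → x ≡ c ⊎ x ≡ d → x ≡ c′ ⊎ x ≡ d′
      target (inj₁ (refl , refl)) h = h
      target (inj₂ (refl , refl)) h = swap h

  GEquals-functional : (φ : Subst n) (u : Stream n) {a b c d c′ d′ : Fin n} → c ≢ d →
                       GEquals φ u a b c d → GEquals φ u a b c′ d′ → SamePair (c , d) (c′ , d′)
  GEquals-functional φ u {c = c} {d} c≢d g g′
    with to (g′ c) (from (g c) (inj₁ refl)) | to (g′ d) (from (g d) (inj₂ refl))
  ... | inj₁ e₁    | inj₂ e₂    = inj₁ (e₁ , e₂)
  ... | inj₂ e₁    | inj₁ e₂    = inj₂ (e₁ , e₂)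
  ... | inj₁ refl  | inj₁ refl  = ⊥-elim (c≢d refl)
  ... | inj₂ refl  | inj₂ refl  = ⊥-elim (c≢d refl)

  GEdge-resp : (φ : Subst n) (u : Stream n) {X X′ Y Y′ : Pair {n}} →
               SamePair X X′ → SamePair Y Y′ → GEdge φ u X Y → GEdge φ u X′ Y′
  GEdge-resp φ u sX sY (a≢b , meet , c≢d , g) =
    distinct sX a≢b , meet-resp sX meet , distinct sY c≢d , GEquals-resp φ u sX sY g
    where
      distinct : ∀ {a b a′ b′ : Fin n} → SamePair (a , b) (a′ , b′) → a ≢ b → a′ ≢ b′
      distinct (inj₁ (refl , refl)) ne = ne
      distinct (inj₂ (refl , refl)) ne = λ e → ne (sym e)
      meet-resp : ∀ {a b a′ b′ : Fin n} → SamePair (a , b) (a′ , b′) →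
                  RextMeet u (a ∷ []) (b ∷ []) → RextMeet u (a′ ∷ []) (b′ ∷ [])
      meet-resp (inj₁ (refl , refl)) m             = m
      meet-resp (inj₂ (refl , refl)) (x , ra , rb) = x , rb , ra

  -- Consequences of primitivity over an alphabet with two distinct letters a ≠ b:
  -- some power φᴷ doubles lengths, φ is non-erasing, and so all powers beyond K double.

  two-letters : (a b : Fin n) (xs : List (Fin n)) → a ∈ xs → b ∈ xs → a ≢ b → 2 ≤ length xs
  two-letters a b (x ∷ y ∷ xs) _          _           _   = s≤s (s≤s z≤n)
  two-letters a b (x ∷ [])     (here refl) (here refl) a≢b = ⊥-elim (a≢b refl)

  module Primitivity (φ : Subst n) (prim : Primitive φ) {a b : Fin n} (a≢b : a ≢ b) where

    K : ℕ
    K = proj₁ prim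

    doubling : Doubling (φpow φ K)
    doubling x = two-letters a b _ (proj₂ prim x a) (proj₂ prim x b) a≢b

    nonErasing : NonErasing φ
    nonErasing x with φ x in eq
    ... | _ ∷ _ = s≤s z≤n
    ... | []    = ⊥-elim (shortPower K (doubling x))
      where
        -- an erased letter stays erased under all positive powers
        erased : ∀ k → φpow φ (suc k) x ≡ []
        erased k = trans (cong (λ m → φpow φ m x) (+-comm 1 k))
                         (trans (φpow-+ φ k 1 x) (cong (img (φpow φ k)) (trans (++-identityʳ (φ x)) eq)))
        shortPower : ∀ k → ¬ (2 ≤ length (φpow φ k x))
        shortPower zero    (s≤s ())
        shortPower (suc k) h with subst (λ v → 2 ≤ length v) (erased k) h
        ... | ()

    doubling-beyond : ∀ m → K ≤ m → Doubling (φpow φ m)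
    doubling-beyond m K≤m x =
      subst (λ k → 2 ≤ length (φpow φ k x)) (m∸n+n≡m K≤m)
        (subst (λ v → 2 ≤ length v) (sym (φpow-+ φ (m ∸ K) K x))
          (≤-trans (doubling x) (img-length _ (φpow-nonErasing φ nonErasing (m ∸ K)) (φpow φ K x))))

module Construction {n : ℕ} (φ : Subst n) (u : Stream n) (prim : Primitive φ) (AB : AssumptionB φ u)
  (w : Stream n) (lsb : LSBranch u w) (a b : Fin n) (a≢b : a ≢ b)
  (la : InLextInf u a w) (lb : InLextInf u b w) where

  open Primitivity φ prim a≢b

  record Branch : Set where
    constructor branch
    field
      word        : Stream n
      isBranch    : LSBranch u word
      left right  : Fin n
      distinct    : left ≢ right
      leftExt     : InLextInf u left word
      rightExt    : InLextInf u right word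

  open Branch

  pair : Branch → Pair {n}
  pair B = left B , right B

  earlier : (B : Branch) → ∃ λ B′ → CatImgEq (label φ (pair B′)) φ (word B′) (word B)
                                   × GEquals φ u (left B′) (right B′) (left B) (right B)
  earlier (branch v br c d c≢d lc ld) =
    let (v′ , c′ , d′ , br′ , c′≢d′ , lc′ , ld′ , rel , g) = proj₂ AB v br c d c≢d lc ld
    in branch v′ br′ c′ d′ c′≢d′ lc′ ld′ , rel , g

  chain : ℕ → Branch
  chain zero    = branch w lsb a b a≢b la lb
  chain (suc k) = proj₁ (earlier (chain k))

  W : ℕ → Stream n
  W k = word (chain k)

  q : ℕ → Pair {n}
  q k = pair (chain k)

  step : ∀ k → CatImgEq (label φ (q (suc k))) φ (W (suc k)) (W k)
  step k = proj₁ (proj₂ (earlier (chain k)))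

  edge : ∀ k → GEdge φ u (q (suc k)) (q k)
  edge k = distinct B′ , (word B′ 0 , leftExt B′ 1 , rightExt B′ 1) , distinct (chain k) ,
           proj₂ (proj₂ (earlier (chain k)))
    where B′ = chain (suc k)

  -- since g_L is a function, the pair sequence is backward deterministic
  backward : ∀ {s t} → SamePair (q (suc s)) (q (suc t)) → SamePair (q s) (q t)
  backward {s} {t} h =
    GEquals-functional φ u (distinct (chain s)) (proj₂ (proj₂ (earlier (chain s))))
      (GEquals-resp φ u (SamePair-sym h) SamePair-refl (proj₂ (proj₂ (earlier (chain t)))))

  module Pairs = BackwardDeterministic pairSetoid (n * n) pairCode pairCode-reflects q
                                      (λ {s} {t} → backward {s} {t})

  firstReturn : ∃ λ k → SamePair (q 0) (q (suc k)) × (∀ j → j < k → ¬ SamePair (q 0) (q (suc j)))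
  firstReturn = least _ (λ t → SamePair? (q 0) (q (suc t)))
                      (proj₁ Pairs.recurrence) (proj₂ Pairs.recurrence)

  D : ℕ
  D = suc (proj₁ firstReturn)

  q0≈qD : SamePair (q 0) (q D)
  q0≈qD = proj₁ (proj₂ firstReturn)

  -- the cycle through {a,b}: the pairs q D, q (D-1), …, q 1, read along the edges of GL_φ
  p : ℕ → Pair {n}
  p zero    = q 0
  p (suc i) = q (D ∸ suc i)

  p≈q : ∀ i → SamePair (p i) (q (D ∸ i))
  p≈q zero    = q0≈qD
  p≈q (suc i) = SamePair-refl

  cycle : Cycle φ u a b D p
  cycle = s≤s z≤n , refl , edges , closes , simple
    where
      edges : ∀ i → i < D → GEdge φ u (p i) (p (suc i))
      edges i i<D = GEdge-resp φ u
        (subst (λ m → SamePair (q m) (p i)) (+-∸-assoc 1 i<D) (SamePair-sym (p≈q i)))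
        SamePair-refl (edge (D ∸ suc i))
      closes : SamePair (p D) (p 0)
      closes = subst (λ m → SamePair (q m) (q 0)) (sym (n∸n≡0 (proj₁ firstReturn))) SamePair-refl
      simple : ∀ i j → i < j → j < D → ¬ SamePair (p i) (p j)
      simple i j i<j j<D same = proj₂ (proj₂ firstReturn) (j ∸ suc i) bound
          (Pairs.shiftBack (D ∸ j) 0 (suc (j ∸ suc i))
            (subst₂ (λ m m′ → SamePair (q m) (q m′)) (sym (+-identityʳ (D ∸ j))) split
              (SamePair-trans (SamePair-sym (p≈q j)) (SamePair-trans (SamePair-sym same) (p≈q i)))))
        where
          gap : j ∸ i ≡ suc (j ∸ suc i)
          gap = +-∸-assoc 1 i<j
          split : D ∸ i ≡ (D ∸ j) + suc (j ∸ suc i)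
          split = trans (cong (_∸ i) (sym (m∸n+n≡m (<⇒≤ j<D))))
                        (trans (+-∸-assoc (D ∸ j) (<⇒≤ i<j)) (cong ((D ∸ j) +_) gap))
          bound : j ∸ suc i < proj₁ firstReturn
          bound = subst (_≤ proj₁ firstReturn) gap (≤-trans (m∸n≤m j i) (m<1+n⇒m≤n j<D))

  -- Every D steps the chain reads the same word s along the cycle:  V m = s ψ(V (m+1)).
  s : List (Fin n)
  s = sWord φ p D

  ψ : Subst n
  ψ = φpow φ D

  ψ-nonErasing : NonErasing ψ
  ψ-nonErasing = φpow-nonErasing φ nonErasing D

  V : ℕ → Stream n
  V m = W (m * D)

  labels-periodic : ∀ m i → i < D → label φ (p i) ≡ label φ (q (suc (m * D + (D ∸ suc i))))
  labels-periodic m i i<D = label-resp φ (SamePair-trans (p≈q i)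
    (subst (λ k → SamePair (q (D ∸ i)) (q k)) index (Pairs.periodic-* q0≈qD m (D ∸ i))))
    where
      index : D ∸ i + m * D ≡ suc (m * D + (D ∸ suc i))
      index = trans (cong (_+ m * D) (+-∸-assoc 1 i<D)) (cong suc (+-comm (D ∸ suc i) (m * D)))

  block : ∀ m → CatImgEq s ψ (V (suc m)) (V m)
  block m = subst (λ v → CatImgEq v ψ (V (suc m)) (V m))
                  (telescope-sWord φ (λ j → label φ (q (suc j))) p D (m * D) (labels-periodic m))
                  (telescope-relation φ nonErasing (λ j → label φ (q (suc j))) W step D (m * D))

  nonemptyCase : 1 ≤ length s →
    ∃ λ ℓ → ∃ λ p′ → Cycle φ u a b ℓ p′
      × (∃ λ i → i < ℓ × label φ (p′ i) ≢ [])
      × CatImgEq (sWord φ p′ ℓ) (φpow φ ℓ) w w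
      × ((k : ℕ) → PrefixS (partialCat φ (sWord φ p′ ℓ) ℓ k) w)
      × ((w′ : Stream n) → CatImgEq (sWord φ p′ ℓ) (φpow φ ℓ) w′ w′ → (i : ℕ) → w′ i ≡ w i)
  nonemptyCase 1≤s =
    D , p , cycle , sWord-nonempty φ p D 1≤s ,
    approx-solution s ψ [] ψ-nonErasing long w onW ,
    (λ k → subst (λ v → PrefixS v w) (sym (partialCat-approx φ s D k)) (onW k)) ,
    λ w′ w′≡sψw′ → approx-unique s ψ [] long w′ w
      (λ k → approx-prefix s ψ [] (λ _ → w′) (λ _ → w′≡sψw′) (λ _ → refl) k 0) onW
    where
      long : ∀ k → k ≤ length (approx s ψ [] k)
      long = approx-long s ψ [] 1≤s ψ-nonErasing
      onW : ∀ k → PrefixS (approx s ψ [] k) w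
      onW k = approx-prefix s ψ [] V block (λ _ → refl) k 0

  -- Case s = ε:  V m = ψ(V (m+1)), so the first letter of V m is the first letter of
  -- ψ(first letter of V (m+1)).  These letters are backward deterministic, hence periodic;
  -- for a multiple T of their period with T·D beyond the primitivity exponent, the words
  -- Z j = V (j·T) satisfy Z j = χ(Z (j+1)) for the doubling morphism χ = ψᵀ = φ^{T·D},
  -- and all begin with the same letter, which makes w = Z 0 a fixed point of χ.
  emptyCase : s ≡ [] →
    ∃ λ ℓ → 1 ≤ ℓ × ImgEq (φpow φ ℓ) w w
      × ∃ λ m → ∃ λ p′ → Cycle φ u a b m p′ × ((i : ℕ) → i < m → label φ (p′ i) ≡ [])
  emptyCase s≡[] =
    T * D , ≤-trans (s≤s z≤n) K<TD ,
    imgEq-cong χ (φpow φ (T * D)) w w (φpow-* φ D T) (proj₂ fixed) ,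
    D , p , cycle , sWord-empty φ nonErasing p D s≡[]
    where
      emptyBlock : ∀ m → CatImgEq [] ψ (V (suc m)) (V m)
      emptyBlock m = subst (λ v → CatImgEq v ψ (V (suc m)) (V m)) s≡[] (block m)

      y : ℕ → Fin n
      y m = V m 0

      firstLetter : ∀ m → head (ψ (y (suc m))) ≡ just (y m)
      firstLetter m = prefix-head (ψ (y (suc m))) (V m)
        (proj₁ (prefix-split (ψ (y (suc m))) [] (V m) (catImg-prefix [] ψ _ _ (emptyBlock m) 1)))
        (ψ-nonErasing (y (suc m)))

      module Letters = BackwardDeterministic (setoid (Fin n)) n id id y
        (λ {s′} {t′} e → just-injective
          (trans (sym (firstLetter s′)) (trans (cong (head ∘ ψ) e) (firstLetter t′))))

      P : ℕ
      P = proj₁ Letters.recurrence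

      T : ℕ
      T = suc K * suc P

      y-periodic : ∀ j → y (j * T) ≡ y 0
      y-periodic j = sym (trans (Letters.periodic-* (proj₂ Letters.recurrence) (j * suc K) 0)
                                (cong y (*-assoc j (suc K) (suc P))))

      K<TD : suc K ≤ T * D
      K<TD = ≤-trans (m≤m*n (suc K) (suc P)) (m≤m*n T D)

      χ : Subst n
      χ = φpow ψ T

      χ-doubling : Doubling χ
      χ-doubling x = subst (λ v → 2 ≤ length v) (sym (φpow-* φ D T x))
                           (doubling-beyond (T * D) (≤-trans (n≤1+n K) K<TD) x)

      Z : ℕ → Stream n
      Z j = V (j * T)

      Z-chain : ∀ j → CatImgEq [] χ (Z (suc j)) (Z j)
      Z-chain j = subst (λ v → CatImgEq v χ (Z (suc j)) (Z j)) (telescope-empty ψ (j * T) T)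
                        (telescope-relation ψ ψ-nonErasing (λ _ → []) V emptyBlock T (j * T))

      fixed : CatImgEq [] χ w w
      fixed = approx-solution [] χ (y 0 ∷ []) (λ x → ≤-trans (s≤s z≤n) (χ-doubling x))
        (λ k → ≤-trans (n≤1+n k) (approx-long-doubling χ (y 0 ∷ []) χ-doubling (s≤s z≤n) k)) w
        (λ k → approx-prefix [] χ (y 0 ∷ []) Z Z-chain (λ m → cong (_∷ []) (y-periodic m)) k 0)

mainTheorem2 : {n : ℕ} (φ : Subst n) (u : Stream n) →
    Primitive φ → AssumptionB φ u →
    (w : Stream n) → LSBranch u w →
    (a b : Fin n) → a ≢ b → InLextInf u a w → InLextInf u b w →
    (∃ λ ℓ → 1 ≤ ℓ × ImgEq (φpow φ ℓ) w w
      × ∃ λ m → ∃ λ p → Cycle φ u a b m p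
          × ((i : ℕ) → i < m → label φ (p i) ≡ []))
    ⊎
    (∃ λ ℓ → ∃ λ p → Cycle φ u a b ℓ p
      × (∃ λ i → i < ℓ × label φ (p i) ≢ [])
      × CatImgEq (sWord φ p ℓ) (φpow φ ℓ) w w
      × ((k : ℕ) → PrefixS (partialCat φ (sWord φ p ℓ) ℓ k) w)
      × ((w′ : Stream n) → CatImgEq (sWord φ p ℓ) (φpow φ ℓ) w′ w′ →
           (i : ℕ) → w′ i ≡ w i))
mainTheorem2 φ u prim AB w lsb a b a≢b la lb =
  [ inj₁ ∘ emptyCase , inj₂ ∘ nonemptyCase ]′ (empty-or-nonempty s)
  where open Construction φ u prim AB w lsb a b a≢b la lb
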